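{- Let $\alpha\in\mathcal{C}_n$, $i\in[n-1]$ and $z\in[\alpha_i]$. Then: (i) $\alpha$ is $(i,z)$-removable if and only if $c_{i,\tilde J(i,z)}(\alpha)=\alpha_i-\alpha_{\tilde J(i,z)}-z$; (ii) if $\alpha$ is $(i,z)$-removable then $z\leqslant\alpha_i-\alpha_{k_\alpha(i)}$, where $k_\alpha(i)=\min\{k>i:\alpha_k<\alpha_i\}$; (iii) if $\alpha_i>0$ then $\alpha$ is $(i,1)$-removable.
   Context: $[n]=\{1,\dots,n\}$. A (weak) composition is a finite sequence $\alpha=(\alpha_1,\dots,\alpha_m)$ of nonnegative integers with $\alpha_k=0$ for $k>m$; $|\alpha|=\sum_k\alpha_k$. $\mathcal{C}_n$ is the set of compositions $(\alpha_1,\dots,\alpha_{n-1})$ with $0\leqslant\alpha_i\leqslant n-i$. For a composition $\alpha$, a positive integer $i$ and $j\in\mathbb{N}$, $c_{i,j}(\alpha)$ is defined recursively: $c_{i,j}(\alpha)=0$ if $j\leqslant i+1$; for $j>i+1$, $c_{i,j}(\alpha)=c_{i,j-1}(\alpha)+1$ if $\alpha_{j-1}<\alpha_i-c_{i,j-1}(\alpha)$ and $c_{i,j}(\alpha)=c_{i,j-1}(\alpha)$ otherwise. For compositions with $|\alpha|=|\alpha'|+1$, $\alpha$ covers $\alpha'$ (in positions $(i,j)$, $i<j$ positive integers) if: (a1) $\alpha'_i\leqslant\alpha_i-1$; (a2) $\alpha'_j=\alpha_j+\alpha_i-\alpha'_i-1$; (a3) $\alpha'_k=\alpha_k$ for $k\neq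 i,j$; (a4) $c_{i,j}(\alpha)=c_{i,j}(\alpha')=\alpha'_i-\alpha_j$; $\alpha$ covers $\alpha'$ if this holds for some such pair. For $\alpha\in\mathcal{C}_n$, $i\in[n-1]$, $z\in[\alpha_i]$: $\alpha$ is $(i,z)$-removable if there exists a composition $\alpha'$ such that $\alpha$ covers $\alpha'$ and $\alpha'_i=\alpha_i-z$. Let $\tilde\alpha$ be the composition with $\tilde\alpha_i=\alpha_i-z$ and $\tilde\alpha_m=\alpha_m$ for $m\neq i$, and let $\tilde J(i,z)=\max\{j>i: c_{i,j}(\alpha)=c_{i,j}(\tilde\alpha)\}$ (this maximum exists). -}

module Defs where

open import Data.Nat using (ℕ; zero; suc; _+_; _∸_; _≤_; _<_; _≟_; _<?_; _≤?_)
open import Data.List using (List; []; _∷_; length)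
open import Data.Nat.ListAction using (sum)
open import Data.Product using (Σ; _×_; ∃)
open import Relation.Nullary using (yes; no)
open import Relation.Binary.PropositionalEquality using (_≡_; _≢_)

-- A (weak) composition is represented by a list (α₁,…,αₘ) of naturals;
-- entries beyond the list are 0.  Positions are 1-indexed.
Composition : Set
Composition = List ℕ

-- α_k (1-indexed, α_0 is never used; defaults to 0 out of range)
at : Composition → ℕ → ℕ
at []       _             = 0
at (x ∷ xs) zero          = 0
at (x ∷ xs) (suc zero)    = x
at (x ∷ xs) (suc (suc k)) = at xs (suc k)

size : Composition → ℕ
size = sum

InC : ℕ → Composition → Set
InC n α = length α ≡ n ∸ 1 × (∀ i → 1 ≤ i → i ≤ n ∸ 1 → at α i ≤ n ∸ i)

-- c_{i,j}(α) for a sequence α : ℕ → ℕ (1-indexed).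
-- The condition α_{j-1} < α_i - c is equivalent to α_{j-1} < α_i ∸ c
-- (truncated subtraction), since α_{j-1} ≥ 0.
cseq : (ℕ → ℕ) → ℕ → ℕ → ℕ
cseq α i zero = 0
cseq α i (suc j) with suc j ≤? suc i
... | yes _ = 0
... | no  _ with α j <? (α i ∸ cseq α i j)
...   | yes _ = suc (cseq α i j)
...   | no  _ = cseq α i j

c : Composition → ℕ → ℕ → ℕ
c α = cseq (at α)

-- α covers α' in positions (i,j)  (conditions (a1)–(a4);
-- (a4) "c = α'_i - α_j" is written c + α_j = α'_i, equivalent over ℤ)
CoversAt : Composition → Composition → ℕ → ℕ → Set
CoversAt α α' i j =
  size α ≡ size α' + 1 ×
  1 ≤ i × i < j ×
  at α' i + 1 ≤ at α i ×
  at α' j + at α' i + 1 ≡ at α j + at α i ×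
  (∀ k → k ≢ i → k ≢ j → at α' k ≡ at α k) ×
  c α i j ≡ c α' i j ×
  c α i j + at α j ≡ at α' i

Removable : Composition → ℕ → ℕ → Set
Removable α i z = Σ Composition λ α' → Σ ℕ λ j → CoversAt α α' i j × at α' i ≡ at α i ∸ z

tilde : Composition → ℕ → ℕ → (ℕ → ℕ)
tilde α i z m with m ≟ i
... | yes _ = at α i ∸ z
... | no  _ = at α m

IsJtilde : Composition → ℕ → ℕ → ℕ → Set
IsJtilde α i z J =
  (i < J × c α i J ≡ cseq (tilde α i z) i J) ×
  (∀ j → i < j → c α i j ≡ cseq (tilde α i z) i j → j ≤ J)

IsKalpha : Composition → ℕ → ℕ → Set
IsKalpha α i k =
  (i < k × at α k < at α i) ×
  (∀ k' → i < k' → at α k' < at α i → k ≤ k')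

{-# OPTIONS --safe #-}
-- The counter of α̃ never exceeds that of α,
-- and once it falls behind it stays behind, so the positions where they agree form an initial
-- segment ending at J̃. A covering of some α′ with α′ᵢ = αᵢ − z amounts to a position j > i at
-- which the counters agree and c_{i,j}(α) + αⱼ + z = αᵢ; there the counter of α ticks while
-- that of α̃ does not, so j = J̃, which gives (i). For (ii), both counters stay 0 up to k_α(i),
-- and agreement just after k_α(i) forces α_k < αᵢ − z. For (iii), with z = 1 a scan to the
-- right keeps the counters equal until αⱼ meets the slack αᵢ − 1 − c, which must happen
-- because αⱼ = 0 beyond the end of α.
module Submission where

open import Defs
open import Data.Nat using (ℕ; zero; suc; _+_; _∸_; _≤_; _<_; _≤′_; ≤′-step; ≤′-refl; _<?_; _≤?_; _≟_; z≤n; s≤s)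
open import Data.Nat.Properties
open import Data.Nat.ListAction using (sum)
open import Data.Nat.Tactic.RingSolver using (solve-∀)
open import Data.List using (List; []; _∷_; length)
open import Data.Product using (Σ; _×_; _,_)
open import Data.Sum using (_⊎_; inj₁; inj₂)
open import Data.Empty using (⊥-elim)
open import Function.Base using (_∘_)
open import Function.Bundles using (_⇔_; mk⇔)
open import Relation.Nullary using (¬_; Dec; yes; no)
open import Relation.Binary.Definitions using (tri<; tri≈; tri>)
open import Relation.Binary.PropositionalEquality

tick : ℕ → ℕ → ℕ → ℕ
tick x t c with x <? t
... | yes _ = suc c
... | no  _ = c

tick-< : ∀ {x t c} → x < t → tick x t c ≡ suc c
tick-< {x} {t} x<t with x <? t
... | yes _  = refl
... | no x≮t = ⊥-elim (x≮t x<t)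

tick-≮ : ∀ {x t c} → ¬ x < t → tick x t c ≡ c
tick-≮ {x} {t} x≮t with x <? t
... | yes x<t = ⊥-elim (x≮t x<t)
... | no _    = refl

tick-<⁻¹ : ∀ {x t c} → tick x t c ≡ suc c → x < t
tick-<⁻¹ {x} {t} ticked with x <? t
... | yes x<t = x<t
... | no _    = ⊥-elim (1+n≢n (sym ticked))

c≤tick : ∀ x t c → c ≤ tick x t c
c≤tick x t c with x <? t
... | yes _ = n≤1+n c
... | no  _ = ≤-refl

tick≤suc : ∀ x t c → tick x t c ≤ suc c
tick≤suc x t c with x <? t
... | yes _ = ≤-refl
... | no  _ = n≤1+n c

tick-mono-≤ : ∀ x {t₂ t₁ c₂ c₁} → t₂ ≤ t₁ → c₂ ≤ c₁ → tick x t₂ c₂ ≤ tick x t₁ c₁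
tick-mono-≤ x {t₂} {t₁} t₂≤t₁ c₂≤c₁ with x <? t₂ | x <? t₁
... | yes _   | yes _   = s≤s c₂≤c₁
... | yes x<t | no x≮t  = ⊥-elim (x≮t (<-≤-trans x<t t₂≤t₁))
... | no _    | yes _   = m≤n⇒m≤1+n c₂≤c₁
... | no _    | no _    = c₂≤c₁

tick-mono-< : ∀ x {t₂ t₁ c₂ c₁} → t₂ ≤ t₁ → c₂ < c₁ → tick x t₂ c₂ < tick x t₁ c₁
tick-mono-< x {t₂} {t₁} t₂≤t₁ c₂<c₁ with x <? t₂ | x <? t₁
... | yes _   | yes _   = s≤s c₂<c₁
... | yes x<t | no x≮t  = ⊥-elim (x≮t (<-≤-trans x<t t₂≤t₁))
... | no _    | yes _   = m<n⇒m<1+n c₂<c₁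
... | no _    | no _    = c₂<c₁

cseq-start : ∀ f i j → j ≤ suc i → cseq f i j ≡ 0
cseq-start f i zero    _ = refl
cseq-start f i (suc j) j≤ with suc j ≤? suc i
... | yes _ = refl
... | no j≰ = ⊥-elim (j≰ j≤)

cseq-step : ∀ f i j → i < j → cseq f i (suc j) ≡ tick (f j) (f i ∸ cseq f i j) (cseq f i j)
cseq-step f i j i<j with suc j ≤? suc i
... | yes (s≤s j≤i) = ⊥-elim (<⇒≱ i<j j≤i)
... | no _ with f j <? (f i ∸ cseq f i j)
...   | yes _ = refl
...   | no  _ = refl

cseq-cong : ∀ f g i j → f i ≡ g i → (∀ m → m < j → f m ≡ g m) → cseq f i j ≡ cseq g i j
cseq-cong f g i zero    _   _   = refl
cseq-cong f g i (suc j) fᵢ fₘ with i <? j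
... | no i≮j = trans (cseq-start f i (suc j) (s≤s (≮⇒≥ i≮j)))
                     (sym (cseq-start g i (suc j) (s≤s (≮⇒≥ i≮j))))
... | yes i<j
  rewrite cseq-step f i j i<j | cseq-step g i j i<j | fᵢ | fₘ j (n<1+n j)
        | cseq-cong f g i j fᵢ (λ m m<j → fₘ m (m<n⇒m<1+n m<j)) = refl

cseq-zero-while-≥ : ∀ f i k → (∀ m → i < m → m < k → f i ≤ f m) → ∀ m → m ≤ k → cseq f i m ≡ 0
cseq-zero-while-≥ f i k large zero    _   = refl
cseq-zero-while-≥ f i k large (suc m) m<k with i <? m
... | no i≮m = cseq-start f i (suc m) (s≤s (≮⇒≥ i≮m))
... | yes i<m
  rewrite cseq-step f i m i<m | cseq-zero-while-≥ f i k large m (<⇒≤ m<k) =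
    tick-≮ (λ fₘ<fᵢ → <⇒≱ fₘ<fᵢ (large m i<m m<k))

module Lowered (f g : ℕ → ℕ) (i z : ℕ) (gᵢ : g i ≡ f i ∸ z) (gₘ : ∀ m → m ≢ i → g m ≡ f m)
               (1≤z : 1 ≤ z) where

  cseq-lowered-step : ∀ j → i < j →
    cseq g i (suc j) ≡ tick (f j) ((f i ∸ z) ∸ cseq g i j) (cseq g i j)
  cseq-lowered-step j i<j rewrite cseq-step g i j i<j | gᵢ | gₘ j (≢-sym (<⇒≢ i<j)) = refl

  threshold-≤ : ∀ {c₂ c₁} → c₁ ≤ z + c₂ → (f i ∸ z) ∸ c₂ ≤ f i ∸ c₁
  threshold-≤ {c₂} c₁≤ = ≤-trans (≤-reflexive (∸-+-assoc (f i) z c₂)) (∸-monoʳ-≤ (f i) c₁≤)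

  cseq-lowered-≤ : ∀ j → cseq g i j ≤ cseq f i j
  cseq-lowered-<-step : ∀ j → cseq g i j < cseq f i j → cseq g i (suc j) < cseq f i (suc j)

  cseq-lowered-≤ zero = z≤n
  cseq-lowered-≤ (suc j) with i <? j
  ... | no i≮j rewrite cseq-start g i (suc j) (s≤s (≮⇒≥ i≮j)) = z≤n
  ... | yes i<j with m≤n⇒m<n∨m≡n (cseq-lowered-≤ j)
  ...   | inj₁ lt = <⇒≤ (cseq-lowered-<-step j lt)
  ...   | inj₂ eq rewrite cseq-lowered-step j i<j | cseq-step f i j i<j | eq =
    tick-mono-≤ (f j) (threshold-≤ {cseq f i j} (m≤n+m _ z)) ≤-refl

  -- A gap of one unit cannot close since the thresholds are then ordered; a larger gap cannot
  -- close in a single tick.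
  cseq-lowered-<-step j lt with i <? j
  ... | no i≮j rewrite cseq-start f i j (m≤n⇒m≤1+n (≮⇒≥ i≮j)) = ⊥-elim (n≮0 lt)
  ... | yes i<j rewrite cseq-lowered-step j i<j | cseq-step f i j i<j
    with m≤n⇒m<n∨m≡n lt
  ...   | inj₂ eq = tick-mono-< (f j) (threshold-≤ (≤-trans (≤-reflexive (sym eq)) (+-monoˡ-≤ _ 1≤z))) lt
  ...   | inj₁ gap  =
    <-≤-trans (s≤s (tick≤suc (f j) _ (cseq g i j))) (≤-trans gap (c≤tick (f j) _ (cseq f i j)))

  cseq-lowered-<-mono : ∀ {j k} → j ≤′ k → cseq g i j < cseq f i j → cseq g i k < cseq f i k
  cseq-lowered-<-mono ≤′-refl                     lt = lt
  cseq-lowered-<-mono {k = suc k} (≤′-step j≤k) lt = cseq-lowered-<-step k (cseq-lowered-<-mono j≤k lt)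

  agreement-downward-closed : ∀ {j k} → j ≤ k → cseq f i k ≡ cseq g i k → cseq f i j ≡ cseq g i j
  agreement-downward-closed {j} j≤k agreeₖ with m≤n⇒m<n∨m≡n (cseq-lowered-≤ j)
  ... | inj₂ eq = sym eq
  ... | inj₁ lt = ⊥-elim (<⇒≢ (cseq-lowered-<-mono (≤⇒≤′ j≤k) lt) (sym agreeₖ))

  -- The balance makes the threshold of f equal to f j + z and that of g equal to f j.
  agreement-breaks-after : ∀ j → i < j → cseq f i j ≡ cseq g i j → cseq f i j + f j + z ≡ f i →
                           cseq g i (suc j) < cseq f i (suc j)
  agreement-breaks-after j i<j agree sum≡ = begin-strict
    cseq g i (suc j)               ≡⟨ cseq-lowered-step j i<j ⟩
    tick (f j) ((f i ∸ z) ∸ cg) cg ≡⟨ cong (λ c′ → tick (f j) ((f i ∸ z) ∸ c′) c′) (sym agree) ⟩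
    tick (f j) ((f i ∸ z) ∸ cf) cf ≡⟨ tick-≮ (λ lt → n≮n (f j) (subst (f j <_) lowered-threshold lt)) ⟩
    cf                             <⟨ n<1+n cf ⟩
    suc cf                         ≡⟨ tick-< (subst (f j <_) (sym threshold) (m<m+n (f j) 1≤z)) ⟨
    tick (f j) (f i ∸ cf) cf       ≡⟨ cseq-step f i j i<j ⟨
    cseq f i (suc j)               ∎
    where
    open ≤-Reasoning
    cf cg : ℕ
    cf = cseq f i j
    cg = cseq g i j
    threshold : f i ∸ cf ≡ f j + z
    threshold = trans (cong (_∸ cf) (trans (sym sum≡) (+-assoc cf (f j) z))) (m+n∸m≡n cf (f j + z))
    lowered-threshold : (f i ∸ z) ∸ cf ≡ f j
    lowered-threshold = begin-equality
      (f i ∸ z) ∸ cf ≡⟨ ∸-+-assoc (f i) z cf ⟩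
      f i ∸ (z + cf) ≡⟨ cong (f i ∸_) (+-comm z cf) ⟩
      f i ∸ (cf + z) ≡⟨ ∸-+-assoc (f i) cf z ⟨
      (f i ∸ cf) ∸ z ≡⟨ cong (_∸ z) threshold ⟩
      f j + z ∸ z    ≡⟨ m+n∸n≡m (f j) z ⟩
      f j            ∎

-- 1-indexed like at; pads with zeros when k lies beyond the list.
setAt : List ℕ → ℕ → ℕ → List ℕ
setAt xs       zero          v = xs
setAt []       (suc zero)    v = v ∷ []
setAt (x ∷ xs) (suc zero)    v = v ∷ xs
setAt []       (suc (suc k)) v = 0 ∷ setAt [] (suc k) v
setAt (x ∷ xs) (suc (suc k)) v = x ∷ setAt xs (suc k) v

at-zero : ∀ xs → at xs 0 ≡ 0
at-zero []       = refl
at-zero (x ∷ xs) = refl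

at-setAt-≡ : ∀ xs k v → 1 ≤ k → at (setAt xs k v) k ≡ v
at-setAt-≡ []       (suc zero)    v _ = refl
at-setAt-≡ (x ∷ xs) (suc zero)    v _ = refl
at-setAt-≡ []       (suc (suc k)) v _ = at-setAt-≡ [] (suc k) v (s≤s z≤n)
at-setAt-≡ (x ∷ xs) (suc (suc k)) v _ = at-setAt-≡ xs (suc k) v (s≤s z≤n)

at-setAt-≢ : ∀ xs k v m → m ≢ k → at (setAt xs k v) m ≡ at xs m
at-setAt-≢ xs       zero          v m             _   = refl
at-setAt-≢ xs       (suc k)       v zero          _   = trans (at-zero (setAt xs (suc k) v)) (sym (at-zero xs))
at-setAt-≢ xs       (suc zero)    v (suc zero)    m≢k = ⊥-elim (m≢k refl)
at-setAt-≢ []       (suc zero)    v (suc (suc m)) _   = refl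
at-setAt-≢ (x ∷ xs) (suc zero)    v (suc (suc m)) _   = refl
at-setAt-≢ []       (suc (suc k)) v (suc zero)    _   = refl
at-setAt-≢ (x ∷ xs) (suc (suc k)) v (suc zero)    _   = refl
at-setAt-≢ []       (suc (suc k)) v (suc (suc m)) m≢k = at-setAt-≢ [] (suc k) v (suc m) (m≢k ∘ cong suc)
at-setAt-≢ (x ∷ xs) (suc (suc k)) v (suc (suc m)) m≢k = at-setAt-≢ xs (suc k) v (suc m) (m≢k ∘ cong suc)

sum-setAt : ∀ xs k v → 1 ≤ k → sum (setAt xs k v) + at xs k ≡ sum xs + v
sum-setAt []       (suc zero)    v _ = trans (+-identityʳ (v + 0)) (+-identityʳ v)
sum-setAt (x ∷ xs) (suc zero)    v _ = shuffle v (sum xs) x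
  where
  shuffle : ∀ v s x → v + s + x ≡ x + s + v
  shuffle = solve-∀
sum-setAt []       (suc (suc k)) v _ = sum-setAt [] (suc k) v (s≤s z≤n)
sum-setAt (x ∷ xs) (suc (suc k)) v _ = begin
  x + sum (setAt xs (suc k) v) + at xs (suc k)   ≡⟨ +-assoc x _ _ ⟩
  x + (sum (setAt xs (suc k) v) + at xs (suc k)) ≡⟨ cong (x +_) (sum-setAt xs (suc k) v (s≤s z≤n)) ⟩
  x + (sum xs + v)                               ≡⟨ +-assoc x (sum xs) v ⟨
  x + sum xs + v                                 ∎
  where open ≡-Reasoning

at-beyond-length : ∀ xs m → length xs < m → at xs m ≡ 0
at-beyond-length []       m             _       = refl
at-beyond-length (x ∷ xs) (suc (suc m)) (s≤s l<m) = at-beyond-length xs (suc m) l<m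

tilde-≡ : ∀ α i z → tilde α i z i ≡ at α i ∸ z
tilde-≡ α i z with i ≟ i
... | yes _  = refl
... | no i≢i = ⊥-elim (i≢i refl)

tilde-≢ : ∀ α i z m → m ≢ i → tilde α i z m ≡ at α m
tilde-≢ α i z m m≢i with m ≟ i
... | yes m≡i = ⊥-elim (m≢i m≡i)
... | no _    = refl

c-tilde : ∀ α α′ i z j → at α′ i ≡ at α i ∸ z → (∀ m → m < j → m ≢ i → at α′ m ≡ at α m) →
          c α′ i j ≡ cseq (tilde α i z) i j
c-tilde α α′ i z j α′ᵢ α′ₘ = cseq-cong (at α′) (tilde α i z) i j α′ᵢ≡tildeᵢ agree
  where
  α′ᵢ≡tildeᵢ : at α′ i ≡ tilde α i z i
  α′ᵢ≡tildeᵢ = trans α′ᵢ (sym (tilde-≡ α i z))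
  agree : ∀ m → m < j → at α′ m ≡ tilde α i z m
  agree m m<j = by-cases (m ≟ i)
    where
    by-cases : Dec (m ≡ i) → at α′ m ≡ tilde α i z m
    by-cases (yes refl) = α′ᵢ≡tildeᵢ
    by-cases (no m≢i)   = trans (α′ₘ m m<j m≢i) (sym (tilde-≢ α i z m m≢i))

-- A position j at which some α′ covered by α with α′ᵢ = αᵢ − z can receive the removed units.
record RemovalSite (α : Composition) (i z j : ℕ) : Set where
  field
    after     : i < j
    agreement : c α i j ≡ cseq (tilde α i z) i j
    balance   : c α i j + at α j + z ≡ at α i

removable⇒removalSite : ∀ α i z → z ≤ at α i → Removable α i z → Σ ℕ (RemovalSite α i z)
removable⇒removalSite α i z z≤αᵢ (α′ , j , (_ , _ , i<j , _ , _ , α′ₖ , cα≡cα′ , c+αⱼ≡α′ᵢ) , α′ᵢ) =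
  j , record
    { after     = i<j
    ; agreement = trans cα≡cα′ (c-tilde α α′ i z j α′ᵢ (λ m m<j m≢i → α′ₖ m m≢i (<⇒≢ m<j)))
    ; balance   = trans (cong (_+ z) (trans c+αⱼ≡α′ᵢ α′ᵢ)) (m∸n+n≡m z≤αᵢ)
    }

-- α′ moves z − 1 of the z units taken from position i to position j.
removalSite⇒removable : ∀ α i z j → 1 ≤ i → 1 ≤ z → RemovalSite α i z j → Removable α i z
removalSite⇒removable α i (suc z′) j 1≤i _ site =
  α′ , j , (size≡ , 1≤i , i<j , α′ᵢ+1≤αᵢ , moved , α′ₖ , agreement′ , sym α′ᵢ≡x) , α′ᵢ≡αᵢ∸z
  where
  open RemovalSite site renaming (after to i<j)
  A : ℕ → ℕ
  A = at α
  x : ℕ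
  x = c α i j + A j
  α₁ α′ : Composition
  α₁ = setAt α i x
  α′ = setAt α₁ j (A j + z′)
  i≢j : i ≢ j
  i≢j = <⇒≢ i<j
  1≤j : 1 ≤ j
  1≤j = ≤-trans 1≤i (<⇒≤ i<j)
  α′ᵢ≡x : at α′ i ≡ x
  α′ᵢ≡x = trans (at-setAt-≢ α₁ j _ i i≢j) (at-setAt-≡ α i x 1≤i)
  α′ⱼ : at α′ j ≡ A j + z′
  α′ⱼ = at-setAt-≡ α₁ j _ 1≤j
  α′ₖ : ∀ k → k ≢ i → k ≢ j → at α′ k ≡ A k
  α′ₖ k k≢i k≢j = trans (at-setAt-≢ α₁ j _ k k≢j) (at-setAt-≢ α i x k k≢i)
  α′ᵢ≡αᵢ∸z : at α′ i ≡ A i ∸ suc z′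
  α′ᵢ≡αᵢ∸z = trans α′ᵢ≡x (sym (trans (cong (_∸ suc z′) (sym balance)) (m+n∸n≡m x (suc z′))))
  α′ᵢ+1≤αᵢ : at α′ i + 1 ≤ A i
  α′ᵢ+1≤αᵢ rewrite α′ᵢ≡x = subst (x + 1 ≤_) balance (+-monoʳ-≤ x (s≤s z≤n))
  moved : at α′ j + at α′ i + 1 ≡ A j + A i
  moved rewrite α′ᵢ≡x | α′ⱼ = trans (regroup (A j) x z′) (cong (A j +_) balance)
    where
    regroup : ∀ b x z′ → b + z′ + x + 1 ≡ b + (x + suc z′)
    regroup = solve-∀
  agreement′ : c α i j ≡ c α′ i j
  agreement′ = trans agreement (sym (c-tilde α α′ i (suc z′) j α′ᵢ≡αᵢ∸z (λ m m<j m≢i → α′ₖ m m≢i (<⇒≢ m<j))))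
  size≡ : size α ≡ size α′ + 1
  size≡ = +-cancelʳ-≡ (x + A j) (sum α) (sum α′ + 1) (begin
    sum α + (x + A j)                 ≡⟨ +-assoc (sum α) x (A j) ⟨
    sum α + x + A j                   ≡⟨ cong (_+ A j) (sum-setAt α i x 1≤i) ⟨
    sum α₁ + A i + A j                ≡⟨ cong (λ a → sum α₁ + a + A j) balance ⟨
    sum α₁ + (x + suc z′) + A j       ≡⟨ swap-out (sum α₁) x z′ (A j) ⟩
    sum α₁ + (A j + z′) + suc x       ≡⟨ cong (_+ suc x) (sum-setAt α₁ j _ 1≤j) ⟨
    sum α′ + at α₁ j + suc x          ≡⟨ cong (λ a → sum α′ + a + suc x) (at-setAt-≢ α i x j (≢-sym i≢j)) ⟩
    sum α′ + A j + suc x              ≡⟨ swap-in (sum α′) (A j) x ⟩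
    sum α′ + 1 + (x + A j)            ∎)
    where
    open ≡-Reasoning
    swap-out : ∀ s x z′ b → s + (x + suc z′) + b ≡ s + (b + z′) + suc x
    swap-out = solve-∀
    swap-in : ∀ s b x → s + b + suc x ≡ s + 1 + (x + b)
    swap-in = solve-∀

module _ (α : Composition) (i z : ℕ) (1≤z : 1 ≤ z) where
  private
    A T : ℕ → ℕ
    A = at α
    T = tilde α i z
  open Lowered A T i z (tilde-≡ α i z) (tilde-≢ α i z) 1≤z

  removalSite≡Jtilde : ∀ {j J} → IsJtilde α i z J → RemovalSite α i z j → j ≡ J
  removalSite≡Jtilde {j} {J} ((_ , agreeᴶ) , maximal) site =
    by-position (m≤n⇒m<n∨m≡n (maximal j after agreement))
    where
    open RemovalSite site
    by-position : j < J ⊎ j ≡ J → j ≡ J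
    by-position (inj₂ j≡J) = j≡J
    by-position (inj₁ j<J) = ⊥-elim (<⇒≢ (agreement-breaks-after j after agreement balance)
                                          (sym (agreement-downward-closed j<J agreeᴶ)))

  removalSite-bound : ∀ {j k} → RemovalSite α i z j → IsKalpha α i k → z ≤ A i ∸ A k
  removalSite-bound {j} {k} site ((i<k , Aₖ<Aᵢ) , minimal) = by-position (m≤n⇒m<n∨m≡n k≤j)
    where
    open RemovalSite site
    k≤j : k ≤ j
    k≤j = minimal j after (subst (A j <_) balance (≤-<-trans (m≤n+m (A j) (c α i j)) (m<m+n _ 1≤z)))
    large : ∀ m → i < m → m < k → A i ≤ A m
    large m i<m m<k = ≮⇒≥ (λ Aₘ<Aᵢ → <⇒≱ m<k (minimal m i<m Aₘ<Aᵢ))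
    large-T : ∀ m → i < m → m < k → T i ≤ T m
    large-T m i<m m<k rewrite tilde-≡ α i z | tilde-≢ α i z m (≢-sym (<⇒≢ i<m)) =
      ≤-trans (m∸n≤m (A i) z) (large m i<m m<k)
    cₖ≡0 : cseq A i k ≡ 0
    cₖ≡0 = cseq-zero-while-≥ A i k large k ≤-refl
    cₖ-T≡0 : cseq T i k ≡ 0
    cₖ-T≡0 = cseq-zero-while-≥ T i k large-T k ≤-refl
    by-position : k < j ⊎ k ≡ j → z ≤ A i ∸ A k
    by-position (inj₂ refl) = ≤-reflexive (sym (trans (cong (_∸ A k) (sym Aₖ+z≡Aᵢ)) (m+n∸m≡n (A k) z)))
      where
      Aₖ+z≡Aᵢ : A k + z ≡ A i
      Aₖ+z≡Aᵢ = trans (cong (λ c₀ → c₀ + A k + z) (sym cₖ≡0)) balance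
    -- Only α ticks at k when αₖ ≥ αᵢ − z, which would break the agreement at k + 1 ≤ j.
    by-position (inj₁ k<j) =
      m+n≤o⇒m≤o∸n z (subst (_≤ A i) (+-comm (A k) z) (m≤o∸n⇒m+n≤o (A k) z≤Aᵢ (<⇒≤ Aₖ<Aᵢ∸z)))
      where
      z≤Aᵢ : z ≤ A i
      z≤Aᵢ = subst (z ≤_) balance (m≤n+m z _)
      Aₖ<Aᵢ∸z : A k < A i ∸ z
      Aₖ<Aᵢ∸z = tick-<⁻¹ (begin
        tick (A k) ((A i ∸ z) ∸ 0) 0                     ≡⟨ cong (λ c₀ → tick (A k) ((A i ∸ z) ∸ c₀) c₀) cₖ-T≡0 ⟨
        tick (A k) ((A i ∸ z) ∸ cseq T i k) (cseq T i k) ≡⟨ cseq-lowered-step k i<k ⟨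
        cseq T i (suc k)                                 ≡⟨ agreement-downward-closed k<j agreement ⟨
        cseq A i (suc k)                                 ≡⟨ cseq-step A i k i<k ⟩
        tick (A k) (A i ∸ cseq A i k) (cseq A i k)       ≡⟨ cong (λ c₀ → tick (A k) (A i ∸ c₀) c₀) cₖ≡0 ⟩
        tick (A k) (A i) 0                               ≡⟨ tick-< Aₖ<Aᵢ ⟩
        1                                                ∎)
        where open ≡-Reasoning

module _ (α : Composition) (i : ℕ) where
  private
    A T : ℕ → ℕ
    A = at α
    T = tilde α i 1
  open Lowered A T i 1 (tilde-≡ α i 1) (tilde-≢ α i 1) ≤-refl

  -- The invariant of a left-to-right scan for a removal site with z = 1; d is the slack αᵢ − 1 − c.
  record Aligned (j d : ℕ) : Set where
    field
      after     : i < j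
      agreement : cseq A i j ≡ cseq T i j
      slack     : cseq A i j + suc d ≡ A i

  module _ {j d : ℕ} (aligned : Aligned j d) where
    open Aligned aligned

    private
      cⱼ : ℕ
      cⱼ = cseq A i j

    ticks-A : cseq A i (suc j) ≡ tick (A j) (suc d) cⱼ
    ticks-A = trans (cseq-step A i j after) (cong (λ t → tick (A j) t cⱼ) threshold)
      where
      threshold : A i ∸ cⱼ ≡ suc d
      threshold = trans (cong (_∸ cⱼ) (sym slack)) (m+n∸m≡n cⱼ (suc d))

    ticks-T : cseq T i (suc j) ≡ tick (A j) d cⱼ
    ticks-T = trans (cseq-lowered-step j after)
                    (cong₂ (λ t c₀ → tick (A j) t c₀) lowered-threshold (sym agreement))
      where
      lowered-threshold : (A i ∸ 1) ∸ cseq T i j ≡ d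
      lowered-threshold = begin
        (A i ∸ 1) ∸ cseq T i j ≡⟨ cong ((A i ∸ 1) ∸_) agreement ⟨
        (A i ∸ 1) ∸ cⱼ         ≡⟨ ∸-+-assoc (A i) 1 cⱼ ⟩
        A i ∸ suc cⱼ           ≡⟨ cong (_∸ suc cⱼ) (trans (sym slack) (+-suc cⱼ d)) ⟩
        suc cⱼ + d ∸ suc cⱼ    ≡⟨ m+n∸m≡n (suc cⱼ) d ⟩
        d                      ∎
        where open ≡-Reasoning

    aligned-hit : A j ≡ d → RemovalSite α i 1 j
    aligned-hit Aⱼ≡d = record
      { after     = after
      ; agreement = agreement
      ; balance   = trans (cong (λ a → cⱼ + a + 1) Aⱼ≡d)
                          (trans (+-assoc cⱼ d 1) (trans (cong (cⱼ +_) (+-comm d 1)) slack))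
      }

    aligned-above : d < A j → Aligned (suc j) d
    aligned-above d<Aⱼ = record
      { after     = m<n⇒m<1+n after
      ; agreement = trans A-stays (sym (trans ticks-T (tick-≮ (<⇒≱ d<Aⱼ ∘ <⇒≤))))
      ; slack     = trans (cong (_+ suc d) A-stays) slack
      }
      where
      A-stays : cseq A i (suc j) ≡ cⱼ
      A-stays = trans ticks-A (tick-≮ (<⇒≱ d<Aⱼ ∘ ≤-pred))

  aligned-below : ∀ {j d} → Aligned j (suc d) → A j < suc d → Aligned (suc j) d
  aligned-below {j} {d} aligned Aⱼ<d+1 = record
    { after     = m<n⇒m<1+n after
    ; agreement = trans A-ticks (sym (trans (ticks-T aligned) (tick-< Aⱼ<d+1)))
    ; slack     = trans (cong (_+ suc d) A-ticks) (trans (sym (+-suc (cseq A i j) (suc d))) slack)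
    }
    where
    open Aligned aligned
    A-ticks : cseq A i (suc j) ≡ suc (cseq A i j)
    A-ticks = trans (ticks-A aligned) (tick-< (m<n⇒m<1+n Aⱼ<d+1))

  search-past-end : ∀ d j → length α < j → Aligned j d → Σ ℕ (RemovalSite α i 1)
  search-past-end zero    j l<j aligned = j , aligned-hit aligned (at-beyond-length α j l<j)
  search-past-end (suc d) j l<j aligned =
    search-past-end d (suc j) (m<n⇒m<1+n l<j)
      (aligned-below aligned (subst (_< suc d) (sym (at-beyond-length α j l<j)) (s≤s z≤n)))

  -- f bounds the number of positions left before the end of α.
  search : ∀ f j → length α < j + f → ∀ d → Aligned j d → Σ ℕ (RemovalSite α i 1)
  search zero    j l<j d aligned = search-past-end d j (subst (length α <_) (+-identityʳ j) l<j) aligned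
  search (suc f) j l<j d aligned with <-cmp (A j) d
  ... | tri≈ _ Aⱼ≡d _ = j , aligned-hit aligned Aⱼ≡d
  ... | tri> _ _ d<Aⱼ = search f (suc j) (subst (length α <_) (+-suc j f) l<j) d (aligned-above aligned d<Aⱼ)
  search (suc f) j l<j (suc d) aligned | tri< Aⱼ<d _ _ =
    search f (suc j) (subst (length α <_) (+-suc j f) l<j) d (aligned-below aligned Aⱼ<d)

  removalSite-exists : 1 ≤ A i → Σ ℕ (RemovalSite α i 1)
  removalSite-exists 1≤Aᵢ = search (suc (length α)) (suc i) (m≤n+m _ (suc i)) (A i ∸ 1) record
    { after     = n<1+n i
    ; agreement = trans c₀≡0 (sym (cseq-start T i (suc i) ≤-refl))
    ; slack     = trans (cong (_+ suc (A i ∸ 1)) c₀≡0) (m+[n∸m]≡n 1≤Aᵢ)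
    }
    where
    c₀≡0 : cseq A i (suc i) ≡ 0
    c₀≡0 = cseq-start A i (suc i) ≤-refl

removable⇔balance-at-Jtilde : ∀ α i z J → 1 ≤ i → 1 ≤ z → z ≤ at α i → IsJtilde α i z J →
                              Removable α i z ⇔ (c α i J + at α J + z ≡ at α i)
removable⇔balance-at-Jtilde α i z J 1≤i 1≤z z≤αᵢ isJ@((i<J , agreeᴶ) , _) = mk⇔ to from
  where
  to : Removable α i z → c α i J + at α J + z ≡ at α i
  to removable with removable⇒removalSite α i z z≤αᵢ removable
  ... | j , site = subst (λ j′ → c α i j′ + at α j′ + z ≡ at α i)
                         (removalSite≡Jtilde α i z 1≤z isJ site) (RemovalSite.balance site)
  from : c α i J + at α J + z ≡ at α i → Removable α i z
  from balanceᴶ = removalSite⇒removable α i z J 1≤i 1≤z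
    (record { after = i<J ; agreement = agreeᴶ ; balance = balanceᴶ })

removable⇒z≤αᵢ∸αₖ : ∀ α i z k → 1 ≤ z → z ≤ at α i → Removable α i z → IsKalpha α i k →
                    z ≤ at α i ∸ at α k
removable⇒z≤αᵢ∸αₖ α i z k 1≤z z≤αᵢ removable isK with removable⇒removalSite α i z z≤αᵢ removable
... | _ , site = removalSite-bound α i z 1≤z site isK

removable-one : ∀ α i → 1 ≤ i → 1 ≤ at α i → Removable α i 1
removable-one α i 1≤i 1≤αᵢ with removalSite-exists α i 1≤αᵢ
... | j , site = removalSite⇒removable α i 1 j 1≤i ≤-refl site

proposition3p5 : (n : ℕ) (α : Composition) (i : ℕ) → InC n α → 1 ≤ i → i ≤ n ∸ 1 →
    ((z : ℕ) → 1 ≤ z → z ≤ at α i →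
      ((J : ℕ) → IsJtilde α i z J → (Removable α i z ⇔ (c α i J + at α J + z ≡ at α i)))
      × (Removable α i z → (k : ℕ) → IsKalpha α i k → z ≤ at α i ∸ at α k))
    × (1 ≤ at α i → Removable α i 1)
proposition3p5 n α i _ 1≤i _ =
  (λ z 1≤z z≤αᵢ → (λ J → removable⇔balance-at-Jtilde α i z J 1≤i 1≤z z≤αᵢ)
                 , (λ removable k → removable⇒z≤αᵢ∸αₖ α i z k 1≤z z≤αᵢ removable))
  , removable-one α i 1≤i
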